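{- Let $\mathfrak{a}$ be a fractional ideal of $K$, and let $m,n,x,y\in K$ with $my-nx=1$, such that, putting $\mathfrak{a}_M=(m)+(n)$, we have $x,y\in\mathfrak{a}_M^{ -1}$. Let $L_0=\{cx+dy:(c,d)\in\mathfrak{a}\times\mathfrak{a},\ cm+dn=0\}$. Then $L_0=\mathfrak{a}\mathfrak{a}_M^{ -1}$.
   Context: $K$ is an imaginary quadratic field with ring of integers $\mathscr{O}$; $(m)+(n)$ denotes the fractional ideal generated by $m$ and $n$ (these are not both zero since $my-nx=1$). -}

module Defs where

open import Data.Nat as ℕ using (ℕ; _≤_)
open import Data.Nat.Divisibility using (_∣_)
open import Data.Integer as ℤ using (ℤ)
open import Data.Rational as ℚ using (ℚ; 0ℚ; 1ℚ)
open import Data.List using (List; []; _∷_; _++_)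
open import Data.Product using (Σ; _×_; _,_; ∃)
open import Relation.Binary.PropositionalEquality using (_≡_; _≢_)

SquareFree : ℕ → Set
SquareFree d = ∀ (p : ℕ) → (p ℕ.* p) ∣ d → p ≡ 1

-- Elements of K = ℚ(√-d): a + b√-d is represented by the pair (a , b).
-- (1, √-d) is a ℚ-basis of K, so this representation is unique.
K : Set
K = ℚ × ℚ

module Field (d : ℕ) where
  δ : ℚ
  δ = ℤ.+ d ℚ./ 1

  ι : ℚ → K
  ι a = (a , 0ℚ)

  0K 1K : K
  0K = ι 0ℚ
  1K = ι 1ℚ

  _+K_ : K → K → K
  (a , b) +K (c , e) = (a ℚ.+ c , b ℚ.+ e)

  -K_ : K → K
  -K (a , b) = (ℚ.- a , ℚ.- b)

  _-K_ : K → K → K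
  x -K y = x +K (-K y)

  -- (a + b√-d)(c + e√-d) = (ac - d·be) + (ae + bc)√-d
  _*K_ : K → K → K
  (a , b) *K (c , e) = (a ℚ.* c ℚ.- δ ℚ.* (b ℚ.* e) , a ℚ.* e ℚ.+ b ℚ.* c)

  infixl 6 _+K_ _-K_
  infixl 7 _*K_

  fromℤ : ℤ → K
  fromℤ z = ι (z ℚ./ 1)

  -- Horner evaluation of a polynomial with integer coefficients
  -- given from the constant term upwards: c₀ + c₁ X + … .
  evalPoly : List ℤ → K → K
  evalPoly []       z = 0K
  evalPoly (c ∷ cs) z = fromℤ c +K z *K evalPoly cs z

  IsIntegral : K → Set
  IsIntegral z = Σ (List ℤ) λ cs → evalPoly (cs ++ (ℤ.+ 1 ∷ [])) z ≡ 0K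

  Sub : Set₁
  Sub = K → Set

  _⊆_ : Sub → Sub → Set
  A ⊆ B = ∀ z → A z → B z

  record IsFractionalIdeal (I : Sub) : Set where
    field
      zero-mem  : I 0K
      add-mem   : ∀ u v → I u → I v → I (u +K v)
      smul-mem  : ∀ r u → IsIntegral r → I u → I (r *K u)
      nonzero   : Σ K λ u → u ≢ 0K × I u
      bounded   : Σ K λ c → c ≢ 0K × IsIntegral c × (∀ u → I u → IsIntegral (c *K u))

  gen₂ : K → K → Sub
  gen₂ m n z = Σ K λ α → Σ K λ β →
    IsIntegral α × IsIntegral β × z ≡ α *K m +K β *K n

  inv : Sub → Sub
  inv B z = ∀ u → B u → IsIntegral (z *K u)

  data Prod (A B : Sub) : Sub where
    prod-zero : Prod A B 0K
    prod-gen  : ∀ a b → A a → B b → Prod A B (a *K b)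
    prod-add  : ∀ u v → Prod A B u → Prod A B v → Prod A B (u +K v)

  L₀ : Sub → K → K → K → K → Sub
  L₀ 𝔞 m n x y z = Σ K λ c → Σ K λ e →
    𝔞 c × 𝔞 e × c *K m +K e *K n ≡ 0K × z ≡ c *K x +K e *K y

  _≐_ : Sub → Sub → Set
  A ≐ B = A ⊆ B × B ⊆ A

-- For a ∈ 𝔞 and b ∈ 𝔞_M⁻¹ put c = −a(bn) and e = a(bm). Both lie in 𝔞, since bm and bn
-- are integral, and cm + en = 0 while cx + ey = ab(my − nx) = ab. Hence L₀, which is an
-- additive group, contains every generator of 𝔞𝔞_M⁻¹. Conversely each cx + ey is a sum of
-- two such generators because x, y ∈ 𝔞_M⁻¹.
module Submission where

open import Defs
open import Data.Nat using (ℕ; _≤_)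
open import Data.Integer using (+_; -[1+_])
open import Data.Rational using (0ℚ)
import Data.Rational.Properties as ℚ
open import Data.Product using (_,_)
open import Data.List using (_∷_; [])
open import Relation.Nullary.Decidable using (dec⇒maybe)
open import Level using (0ℓ)
open import Algebra.Bundles using (CommutativeRing)
import Algebra.Properties.Ring as RingProperties
import Algebra.Solver.Ring.NaturalCoefficients.Default as NaturalCoefficientsSolver
import Relation.Binary.Reasoning.Setoid as SetoidReasoning
open import Tactic.RingSolver.Core.AlmostCommutativeRing using (AlmostCommutativeRing; fromCommutativeRing)
open import Tactic.RingSolver using (solve)
open import Relation.Binary.PropositionalEquality using (_≡_)

module CommutativeRingIdentities {c ℓ} (R : CommutativeRing c ℓ) where
  open CommutativeRing R
  open RingProperties ring using (-‿distribˡ-*; -‿distribʳ-*)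
  open NaturalCoefficientsSolver commutativeSemiring using (_:=_; _:+_; _:*_)
    renaming (solve to solve-R)
  open SetoidReasoning setoid

  linear-combination-+ : ∀ c₁ e₁ c₂ e₂ u v →
    (c₁ + c₂) * u + (e₁ + e₂) * v ≈ (c₁ * u + e₁ * v) + (c₂ * u + e₂ * v)
  linear-combination-+ = solve-R 6
    (λ c₁ e₁ c₂ e₂ u v →
      (c₁ :+ c₂) :* u :+ (e₁ :+ e₂) :* v := (c₁ :* u :+ e₁ :* v) :+ (c₂ :* u :+ e₂ :* v))
    refl

  linear-combination-0 : ∀ u v → 0# * u + 0# * v ≈ 0#
  linear-combination-0 u v = begin
    0# * u + 0# * v  ≈⟨ +-cong (zeroˡ u) (zeroˡ v) ⟩
    0# + 0#          ≈⟨ +-identityˡ 0# ⟩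
    0#               ∎

  relation-vanishes : ∀ a b m n → - (a * (b * n)) * m + a * (b * m) * n ≈ 0#
  relation-vanishes a b m n = begin
    - (a * (b * n)) * m + a * (b * m) * n  ≈⟨ +-congʳ (sym (-‿distribˡ-* (a * (b * n)) m)) ⟩
    - (a * (b * n) * m) + a * (b * m) * n  ≈⟨ +-congʳ (-‿cong (swap a b n m)) ⟩
    - (a * (b * m) * n) + a * (b * m) * n  ≈⟨ -‿inverseˡ (a * (b * m) * n) ⟩
    0#                                     ∎
    where
    swap : ∀ a b n m → a * (b * n) * m ≈ a * (b * m) * n
    swap = solve-R 4 (λ a b n m → a :* (b :* n) :* m := a :* (b :* m) :* n) refl

  relation-recovers-product : ∀ {m n x y} → m * y - n * x ≈ 1# →
    ∀ a b → - (a * (b * n)) * x + a * (b * m) * y ≈ a * b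
  relation-recovers-product {m} {n} {x} {y} det a b = begin
    - (a * (b * n)) * x + a * (b * m) * y  ≈⟨ +-cong (sym (-‿distribˡ-* (a * (b * n)) x)) (regroup a b m y) ⟩
    - (a * (b * n) * x) + a * b * (m * y)  ≈⟨ +-congʳ (-‿cong (regroup a b n x)) ⟩
    - (a * b * (n * x)) + a * b * (m * y)  ≈⟨ +-comm (- (a * b * (n * x))) (a * b * (m * y)) ⟩
    a * b * (m * y) + - (a * b * (n * x))  ≈⟨ +-congˡ (-‿distribʳ-* (a * b) (n * x)) ⟩
    a * b * (m * y) + a * b * - (n * x)    ≈⟨ sym (distribˡ (a * b) (m * y) (- (n * x))) ⟩
    a * b * (m * y - n * x)                ≈⟨ *-congˡ det ⟩
    a * b * 1#                             ≈⟨ *-identityʳ (a * b) ⟩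
    a * b                                  ∎
    where
    regroup : ∀ a b m y → a * (b * m) * y ≈ a * b * (m * y)
    regroup = solve-R 4 (λ a b m y → a :* (b :* m) :* y := a :* b :* (m :* y)) refl

ℚ-ring : AlmostCommutativeRing 0ℓ 0ℓ
ℚ-ring = fromCommutativeRing ℚ.+-*-commutativeRing (λ q → dec⇒maybe (0ℚ ℚ.≟ q))

module QuadraticField (d : ℕ) where
  open import Data.Rational using (1ℚ; _+_; _*_; _-_)
  open import Relation.Binary.PropositionalEquality
    using (refl; sym; trans; cong; cong₂; subst; isEquivalence; module ≡-Reasoning)
  open Field d
  open ≡-Reasoning

  +K-assoc : ∀ x y z → (x +K y) +K z ≡ x +K (y +K z)
  +K-assoc (a , b) (c , e) (f , g) = cong₂ _,_ (ℚ.+-assoc a c f) (ℚ.+-assoc b e g)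

  +K-comm : ∀ x y → x +K y ≡ y +K x
  +K-comm (a , b) (c , e) = cong₂ _,_ (ℚ.+-comm a c) (ℚ.+-comm b e)

  +K-identityˡ : ∀ x → 0K +K x ≡ x
  +K-identityˡ (a , b) = cong₂ _,_ (ℚ.+-identityˡ a) (ℚ.+-identityˡ b)

  +K-identityʳ : ∀ x → x +K 0K ≡ x
  +K-identityʳ (a , b) = cong₂ _,_ (ℚ.+-identityʳ a) (ℚ.+-identityʳ b)

  -K-inverseˡ : ∀ x → (-K x) +K x ≡ 0K
  -K-inverseˡ (a , b) = cong₂ _,_ (ℚ.+-inverseˡ a) (ℚ.+-inverseˡ b)

  -K-inverseʳ : ∀ x → x +K (-K x) ≡ 0K
  -K-inverseʳ (a , b) = cong₂ _,_ (ℚ.+-inverseʳ a) (ℚ.+-inverseʳ b)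

  -- The component identities are quantified over δ so that the solver treats it as a variable.
  *K-comm : ∀ x y → x *K y ≡ y *K x
  *K-comm (a , b) (c , e) = cong₂ _,_ (re δ) (solve (a ∷ b ∷ c ∷ e ∷ []) ℚ-ring)
    where
    re : ∀ δ → a * c - δ * (b * e) ≡ c * a - δ * (e * b)
    re δ = solve (δ ∷ a ∷ b ∷ c ∷ e ∷ []) ℚ-ring

  *K-identityˡ : ∀ x → 1K *K x ≡ x
  *K-identityˡ (a , b) = cong₂ _,_ (re δ) (solve (a ∷ b ∷ []) ℚ-ring)
    where
    re : ∀ δ → 1ℚ * a - δ * (0ℚ * b) ≡ a
    re δ = solve (δ ∷ a ∷ b ∷ []) ℚ-ring

  *K-identityʳ : ∀ x → x *K 1K ≡ x
  *K-identityʳ x = trans (*K-comm x 1K) (*K-identityˡ x)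

  *K-assoc : ∀ x y z → (x *K y) *K z ≡ x *K (y *K z)
  *K-assoc (a , b) (c , e) (f , g) = cong₂ _,_ (re δ) (im δ)
    where
    re : ∀ δ → (a * c - δ * (b * e)) * f - δ * ((a * e + b * c) * g)
             ≡ a * (c * f - δ * (e * g)) - δ * (b * (c * g + e * f))
    re δ = solve (δ ∷ a ∷ b ∷ c ∷ e ∷ f ∷ g ∷ []) ℚ-ring
    im : ∀ δ → (a * c - δ * (b * e)) * g + (a * e + b * c) * f
             ≡ a * (c * g + e * f) + b * (c * f - δ * (e * g))
    im δ = solve (δ ∷ a ∷ b ∷ c ∷ e ∷ f ∷ g ∷ []) ℚ-ring

  *K-distribˡ : ∀ x y z → x *K (y +K z) ≡ x *K y +K x *K z
  *K-distribˡ (a , b) (c , e) (f , g) = cong₂ _,_ (re δ) im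
    where
    re : ∀ δ → a * (c + f) - δ * (b * (e + g)) ≡ (a * c - δ * (b * e)) + (a * f - δ * (b * g))
    re δ = solve (δ ∷ a ∷ b ∷ c ∷ e ∷ f ∷ g ∷ []) ℚ-ring
    im : a * (e + g) + b * (c + f) ≡ (a * e + b * c) + (a * g + b * f)
    im = solve (a ∷ b ∷ c ∷ e ∷ f ∷ g ∷ []) ℚ-ring

  *K-distribʳ : ∀ x y z → (y +K z) *K x ≡ y *K x +K z *K x
  *K-distribʳ x y z = begin
    (y +K z) *K x     ≡⟨ *K-comm (y +K z) x ⟩
    x *K (y +K z)     ≡⟨ *K-distribˡ x y z ⟩
    x *K y +K x *K z  ≡⟨ cong₂ _+K_ (*K-comm x y) (*K-comm x z) ⟩
    y *K x +K z *K x  ∎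

  K-commutativeRing : CommutativeRing 0ℓ 0ℓ
  K-commutativeRing = record
    { Carrier = K ; _≈_ = _≡_ ; _+_ = _+K_ ; _*_ = _*K_ ; -_ = (-K_) ; 0# = 0K ; 1# = 1K
    ; isCommutativeRing = record
      { isRing = record
        { +-isAbelianGroup = record
          { isGroup = record
            { isMonoid = record
              { isSemigroup = record
                { isMagma = record { isEquivalence = isEquivalence ; ∙-cong = cong₂ _+K_ }
                ; assoc = +K-assoc }
              ; identity = +K-identityˡ , +K-identityʳ }
            ; inverse = -K-inverseˡ , -K-inverseʳ
            ; ⁻¹-cong = cong (-K_) }
          ; comm = +K-comm }
        ; *-cong = cong₂ _*K_
        ; *-assoc = *K-assoc
        ; *-identity = *K-identityˡ , *K-identityʳ
        ; distrib = *K-distribˡ , *K-distribʳ }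
      ; *-comm = *K-comm } }

  open CommutativeRing K-commutativeRing using (ring; zeroˡ; zeroʳ)
  open RingProperties ring using (-1*x≈-x)
  open CommutativeRingIdentities K-commutativeRing

  isIntegral-root : ∀ c z → fromℤ c +K z ≡ 0K → IsIntegral z
  isIntegral-root c z root = c ∷ [] , (begin
    fromℤ c +K z *K (1K +K z *K 0K)  ≡⟨ cong (λ t → fromℤ c +K z *K (1K +K t)) (zeroʳ z) ⟩
    fromℤ c +K z *K (1K +K 0K)       ≡⟨ cong (λ t → fromℤ c +K z *K t) (+K-identityʳ 1K) ⟩
    fromℤ c +K z *K 1K               ≡⟨ cong (fromℤ c +K_) (*K-identityʳ z) ⟩
    fromℤ c +K z                     ≡⟨ root ⟩
    0K                               ∎)

  0K-isIntegral : IsIntegral 0K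
  0K-isIntegral = isIntegral-root (+ 0) 0K refl

  1K-isIntegral : IsIntegral 1K
  1K-isIntegral = isIntegral-root -[1+ 0 ] 1K refl

  -1K-isIntegral : IsIntegral (-K 1K)
  -1K-isIntegral = isIntegral-root (+ 1) (-K 1K) refl

  gen₂-memˡ : ∀ m n → gen₂ m n m
  gen₂-memˡ m n = 1K , 0K , 1K-isIntegral , 0K-isIntegral , sym (begin
    1K *K m +K 0K *K n  ≡⟨ cong₂ _+K_ (*K-identityˡ m) (zeroˡ n) ⟩
    m +K 0K             ≡⟨ +K-identityʳ m ⟩
    m                   ∎)

  gen₂-memʳ : ∀ m n → gen₂ m n n
  gen₂-memʳ m n = 0K , 1K , 0K-isIntegral , 1K-isIntegral , sym (begin
    0K *K m +K 1K *K n  ≡⟨ cong₂ _+K_ (zeroˡ m) (*K-identityˡ n) ⟩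
    0K +K n             ≡⟨ +K-identityˡ n ⟩
    n                   ∎)

  Prod-least : ∀ {A B S : Sub} → S 0K → (∀ u v → S u → S v → S (u +K v)) →
    (∀ a b → A a → B b → S (a *K b)) → Prod A B ⊆ S
  Prod-least zero∈ add∈ gen∈ _ prod-zero            = zero∈
  Prod-least zero∈ add∈ gen∈ _ (prod-gen a b a∈ b∈) = gen∈ a b a∈ b∈
  Prod-least zero∈ add∈ gen∈ _ (prod-add u v u∈ v∈) =
    add∈ u v (Prod-least zero∈ add∈ gen∈ u u∈) (Prod-least zero∈ add∈ gen∈ v v∈)

  L₀⊆Prod : ∀ {𝔞 B : Sub} {m n x y} → B x → B y → L₀ 𝔞 m n x y ⊆ Prod 𝔞 B
  L₀⊆Prod {x = x} {y} x∈ y∈ _ (c , e , c∈ , e∈ , _ , refl) =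
    prod-add (c *K x) (e *K y) (prod-gen c x c∈ x∈) (prod-gen e y e∈ y∈)

  module _ {𝔞 : Sub} (𝔞-ideal : IsFractionalIdeal 𝔞) where
    open IsFractionalIdeal 𝔞-ideal

    neg-mem : ∀ u → 𝔞 u → 𝔞 (-K u)
    neg-mem u u∈ = subst 𝔞 (-1*x≈-x u) (smul-mem (-K 1K) u -1K-isIntegral u∈)

    smul-memʳ : ∀ r u → IsIntegral r → 𝔞 u → 𝔞 (u *K r)
    smul-memʳ r u r-integral u∈ = subst 𝔞 (*K-comm r u) (smul-mem r u r-integral u∈)

    module _ {m n x y : K} where
      L₀-zero : L₀ 𝔞 m n x y 0K
      L₀-zero = 0K , 0K , zero-mem , zero-mem , linear-combination-0 m n , sym (linear-combination-0 x y)

      L₀-add : ∀ u v → L₀ 𝔞 m n x y u → L₀ 𝔞 m n x y v → L₀ 𝔞 m n x y (u +K v)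
      L₀-add _ _ (c₁ , e₁ , c₁∈ , e₁∈ , rel₁ , refl) (c₂ , e₂ , c₂∈ , e₂∈ , rel₂ , refl) =
        c₁ +K c₂ , e₁ +K e₂ , add-mem c₁ c₂ c₁∈ c₂∈ , add-mem e₁ e₂ e₁∈ e₂∈ ,
        (begin
          (c₁ +K c₂) *K m +K (e₁ +K e₂) *K n            ≡⟨ linear-combination-+ c₁ e₁ c₂ e₂ m n ⟩
          (c₁ *K m +K e₁ *K n) +K (c₂ *K m +K e₂ *K n)  ≡⟨ cong₂ _+K_ rel₁ rel₂ ⟩
          0K +K 0K                                      ≡⟨ +K-identityˡ 0K ⟩
          0K                                            ∎) ,
        sym (linear-combination-+ c₁ e₁ c₂ e₂ x y)

      L₀-prod : m *K y -K n *K x ≡ 1K →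
        ∀ a b → 𝔞 a → inv (gen₂ m n) b → L₀ 𝔞 m n x y (a *K b)
      L₀-prod det a b a∈ b∈ =
        -K (a *K (b *K n)) , a *K (b *K m) ,
        neg-mem (a *K (b *K n)) (scaled n (gen₂-memʳ m n)) , scaled m (gen₂-memˡ m n) ,
        relation-vanishes a b m n , sym (relation-recovers-product det a b)
        where
        scaled : ∀ g → gen₂ m n g → 𝔞 (a *K (b *K g))
        scaled g g∈ = smul-memʳ (b *K g) a (b∈ g g∈) a∈

mainTheorem8 : (d : ℕ) → 1 ≤ d → SquareFree d →
    let open Field d in
    (𝔞 : Sub) → IsFractionalIdeal 𝔞 →
    (m n x y : K) → m *K y -K n *K x ≡ 1K →
    inv (gen₂ m n) x → inv (gen₂ m n) y →
    L₀ 𝔞 m n x y ≐ Prod 𝔞 (inv (gen₂ m n))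
mainTheorem8 d _ _ _ 𝔞-ideal _ _ _ _ det x∈ y∈ =
  L₀⊆Prod x∈ y∈ , Prod-least (L₀-zero 𝔞-ideal) (L₀-add 𝔞-ideal) (L₀-prod 𝔞-ideal det)
  where open QuadraticField d
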